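{- Let $R$ be a lluf subquiver of a quiver $Q$ with $\#\pi_0(R)=\#\pi_0(Q)+1$. If $\operatorname{DE}(R)$ is a facet of $\operatorname{DE}(Q)$, then $Q/R$ is acyclic.
   Context: A quiver is a pair $Q=(Q_0,Q_1)$ with $Q_0$ finite and $Q_1\subset (Q_0\times Q_0)\setminus\{(v,v)\}$. A subquiver $R$ has $R_0\subset Q_0$, $R_1\subset Q_1$; lluf means $R_0=Q_0$. $\varepsilon_{(v,w)}=\kappa_{\{v\}}-\kappa_{\{w\}}\in\mathbb{R}^{Q_0}$ with $\kappa_{\{v\}}$ the indicator of $v$; $\operatorname{DE}(Q)=\operatorname{conv}\{\varepsilon_{(v,w)}\mid(v,w)\in Q_1\}$, similarly $\operatorname{DE}(R)$. $\pi_0$ is the set of connected components (connectivity via undirected walks). Contraction: let $v\sim w$ on $Q_0$ iff $v,w$ are joined by an undirected walk in $R$; $Q/R$ has vertex set $Q_0/\sim$ and edge set $\{([v],[w])\mid (v,w)\in Q_1\setminus R_1\}$. A quiver is acyclic if it has no directed cycle ($v_0,\dots,v_n$, $n>1$, $v_n=v_0$, $(v_t,v_{t+1})$ edges).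
   Formalization: The polytopes $\operatorname{DE}(Q)$ and $\operatorname{DE}(R)$, with the faces and dimensions in the facet condition, are taken in the rational space ℚ^Q₀ instead of $\mathbb{R}^{Q_0}$. -}

module Defs where

open import Data.Nat using (ℕ; zero; suc; _≤_)
open import Data.Fin using (Fin; zero; suc; inject₁; fromℕ; _≟_)
open import Data.Bool using (Bool; true; false; if_then_else_)
open import Data.Rational using (ℚ; 0ℚ; 1ℚ; _+_; _*_; _-_) renaming (_≤_ to _≤ℚ_)
open import Data.Product using (Σ; ∃; ∃-syntax; _×_; _,_)
open import Relation.Nullary using (¬_; does)
open import Relation.Binary.PropositionalEquality using (_≡_)
open import Function.Bundles using (_⇔_)
open import Function.Definitions using (Surjective)

-- Quivers on the vertex set Q₀ = Fin n; edge set Q₁ as a decidable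
-- relation (v , w) ∈ Q₁ iff E v w ≡ true, with no loops.

record Quiver (n : ℕ) : Set where
  field
    E      : Fin n → Fin n → Bool
    noLoop : ∀ v → E v v ≡ false
open Quiver public

Lluf : ∀ {n} → Quiver n → Quiver n → Set
Lluf R Q = ∀ v w → E R v w ≡ true → E Q v w ≡ true

data Conn {n : ℕ} (Q : Quiver n) : Fin n → Fin n → Set where
  here : ∀ {v} → Conn Q v v
  fwd  : ∀ {v w u} → E Q v w ≡ true → Conn Q w u → Conn Q v u
  bwd  : ∀ {v w u} → E Q w v ≡ true → Conn Q w u → Conn Q v u

-- #π₀(Q) ≡ k : there is a surjection Fin n → Fin k whose fibres are
-- exactly the connected components.
NumComponents : ∀ {n} → Quiver n → ℕ → Set
NumComponents {n} Q k =
  Σ (Fin n → Fin k) λ c →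
    Surjective _≡_ _≡_ c × (∀ v w → (c v ≡ c w) ⇔ Conn Q v w)

-- Contraction Q/R, presented on representatives: vertices of Q/R are
-- classes of Fin n under Conn R; ([x],[y]) is an edge iff there is
-- (v , w) ∈ Q₁ ∖ R₁ with v ∼ x and w ∼ y.

ContrEdge : ∀ {n} → Quiver n → Quiver n → Fin n → Fin n → Set
ContrEdge Q R x y =
  ∃[ v ] ∃[ w ] (E Q v w ≡ true × E R v w ≡ false × Conn R v x × Conn R w y)

ContractionAcyclic : ∀ {n} → Quiver n → Quiver n → Set
ContractionAcyclic {n} Q R =
  ¬ (∃[ m ] Σ (Fin (suc m) → Fin n) λ u →
       2 ≤ m
     × Conn R (u (fromℕ m)) (u zero)
     × (∀ (t : Fin m) → ContrEdge Q R (u (inject₁ t)) (u (suc t))))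

Vec : ℕ → Set
Vec n = Fin n → ℚ

sumℚ : ∀ {k} → (Fin k → ℚ) → ℚ
sumℚ {zero}  f = 0ℚ
sumℚ {suc k} f = f zero + sumℚ (λ i → f (suc i))

dot : ∀ {n} → Vec n → Vec n → ℚ
dot a x = sumℚ (λ i → a i * x i)

κ : ∀ {n} → Fin n → Vec n
κ v i = if does (i ≟ v) then 1ℚ else 0ℚ

ε : ∀ {n} → Fin n → Fin n → Vec n
ε v w i = κ v i - κ w i

-- DE(Q) = conv { ε_(v,w) | (v,w) ∈ Q₁ }, as a predicate on ℚ^{Q₀}.
DE : ∀ {n} → Quiver n → Vec n → Set
DE {n} Q x =
  Σ (Fin n → Fin n → ℚ) λ λ' →
      (∀ v w → 0ℚ ≤ℚ λ' v w)
    × (∀ v w → E Q v w ≡ false → λ' v w ≡ 0ℚ)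
    × sumℚ (λ v → sumℚ (λ w → λ' v w)) ≡ 1ℚ
    × (∀ i → x i ≡ sumℚ (λ v → sumℚ (λ w → λ' v w * ε v w i)))

AffInd : ∀ {n k} → (Fin k → Vec n) → Set
AffInd {n} {k} p =
  ∀ (c : Fin k → ℚ) → sumℚ c ≡ 0ℚ
    → (∀ i → sumℚ (λ j → c j * p j i) ≡ 0ℚ)
    → ∀ j → c j ≡ 0ℚ

-- S has k as the maximal number of affinely independent points,
-- i.e. dim S = k - 1 (dim ∅ = -1).
AffRank : ∀ {n} → (Vec n → Set) → ℕ → Set
AffRank {n} S k =
    (Σ (Fin k → Vec n) λ p → (∀ j → S (p j)) × AffInd p)
  × (∀ (p : Fin (suc k) → Vec n) → (∀ j → S (p j)) → ¬ AffInd p)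

IsFace : ∀ {n} → (Vec n → Set) → (Vec n → Set) → Set
IsFace {n} F P =
  Σ (Vec n) λ a → Σ ℚ λ b →
      (∀ x → P x → dot a x ≤ℚ b)
    × (∀ x → F x ⇔ (P x × dot a x ≡ b))

IsFacet : ∀ {n} → (Vec n → Set) → (Vec n → Set) → Set
IsFacet F P = IsFace F P × ∃[ k ] (AffRank F k × AffRank P (suc k))

-- Suppose Q/R had a directed cycle, and let (v₀,w₀) ∈ Q₁ ∖ R₁ realise its first edge.
-- Either v₀ and w₀ lie in one component of R, and then, since R has more components than
-- Q, some edge (v₁,w₁) of Q joins two components of R; let A be the component of v₁.
-- Or the cycle leaves the component A of v₀ and later re-enters A along some
-- (v₁,w₁) ∈ Q₁ ∖ R₁. The indicator χ of A, viewed as a linear functional, vanishes on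
-- DE(R), and on (ε_{v₀w₀}, ε_{v₁w₁}) it takes the values (0,1), resp. (1,−1). If
-- a·x ≤ b cuts out the facet DE(R), both points satisfy a·x < b, because ε_{vw} ∉ DE(R)
-- for (v,w) ∉ R₁. The affine functionals a·x − b and χ thus vanish on DE(R) and are
-- independent on the two points, so these points extend any affinely independent family
-- in DE(R) by two; this contradicts dim DE(Q) = dim DE(R) + 1.

module Submission where

open import Defs
open import Algebra.Bundles using (Ring)
open import Data.Bool using (true; false; if_then_else_)
open import Data.Fin using (Fin; zero; suc; inject₁; fromℕ; _≟_)
import Data.Fin.Properties as Fin
open import Data.Nat using (ℕ; zero; suc)
import Data.Nat.Properties as ℕ
open import Data.Product using (∃-syntax; _×_; _,_; proj₁; proj₂)
open import Data.Rational
  using (ℚ; 0ℚ; 1ℚ; _+_; _*_; _-_; -_; _≤_; _<_; _≤?_; nonNegative; negative)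
import Data.Rational.Properties as ℚ
open import Data.Sum using (_⊎_; inj₁; inj₂)
open import Data.Vec.Functional using (_∷_)
open import Function using (_∘_; case_of_)
open import Function.Bundles using (_⇔_; Equivalence)
open import Function.Definitions using (Surjective)
open import Relation.Binary.Definitions using (tri<; tri≈; tri>)
open import Relation.Binary.PropositionalEquality
open import Relation.Nullary using (¬_; Dec; does; yes; no; contradiction)
open import Relation.Nullary.Decidable using (dec-true; dec-false; toWitnessFalse)
open import Relation.Unary using (Decidable)

open import Algebra.Properties.Semiring.Sum (Ring.semiring ℚ.+-*-ring)
  using (sum; sum-cong-≗; sum-replicate-zero; ∑-distrib-+; ∑-comm; *-distribˡ-sum; *-distribʳ-sum)
open import Algebra.Properties.Ring ℚ.+-*-ring
  using (-1*x≈-x; x[y-z]≈xy-xz; x∙y⁻¹≈ε⇒x≈y)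

-- Finite sums

sumℚ≡sum : ∀ {k} (f : Fin k → ℚ) → sumℚ f ≡ sum f
sumℚ≡sum {zero}  f = refl
sumℚ≡sum {suc k} f = cong (f zero +_) (sumℚ≡sum (λ i → f (suc i)))

module _ {k : ℕ} where
  open ≡-Reasoning

  sumℚ-cong : {f g : Fin k → ℚ} → (∀ i → f i ≡ g i) → sumℚ f ≡ sumℚ g
  sumℚ-cong {f} {g} f≗g = begin
    sumℚ f  ≡⟨ sumℚ≡sum f ⟩
    sum f   ≡⟨ sum-cong-≗ f≗g ⟩
    sum g   ≡⟨ sumℚ≡sum g ⟨
    sumℚ g  ∎

  sumℚ-zero : (f : Fin k → ℚ) → (∀ i → f i ≡ 0ℚ) → sumℚ f ≡ 0ℚ
  sumℚ-zero f f≗0 = trans (sumℚ≡sum f) (trans (sum-cong-≗ f≗0) (sum-replicate-zero k))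

  sumℚ-distrib-+ : (f g : Fin k → ℚ) → sumℚ (λ i → f i + g i) ≡ sumℚ f + sumℚ g
  sumℚ-distrib-+ f g = begin
    sumℚ (λ i → f i + g i)  ≡⟨ sumℚ≡sum (λ i → f i + g i) ⟩
    sum (λ i → f i + g i)   ≡⟨ ∑-distrib-+ f g ⟩
    sum f + sum g           ≡⟨ cong₂ _+_ (sumℚ≡sum f) (sumℚ≡sum g) ⟨
    sumℚ f + sumℚ g         ∎

  *-distribˡ-sumℚ : (c : ℚ) (f : Fin k → ℚ) → c * sumℚ f ≡ sumℚ (λ i → c * f i)
  *-distribˡ-sumℚ c f = begin
    c * sumℚ f            ≡⟨ cong (c *_) (sumℚ≡sum f) ⟩
    c * sum f             ≡⟨ *-distribˡ-sum c f ⟩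
    sum (λ i → c * f i)   ≡⟨ sumℚ≡sum (λ i → c * f i) ⟨
    sumℚ (λ i → c * f i)  ∎

  *-distribʳ-sumℚ : (c : ℚ) (f : Fin k → ℚ) → sumℚ f * c ≡ sumℚ (λ i → f i * c)
  *-distribʳ-sumℚ c f = begin
    sumℚ f * c            ≡⟨ cong (_* c) (sumℚ≡sum f) ⟩
    sum f * c             ≡⟨ *-distribʳ-sum c f ⟩
    sum (λ i → f i * c)   ≡⟨ sumℚ≡sum (λ i → f i * c) ⟨
    sumℚ (λ i → f i * c)  ∎

  sumℚ-neg : (f : Fin k → ℚ) → sumℚ (λ i → - f i) ≡ - sumℚ f
  sumℚ-neg f = begin
    sumℚ (λ i → - f i)       ≡⟨ sumℚ-cong (λ i → -1*x≈-x (f i)) ⟨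
    sumℚ (λ i → - 1ℚ * f i)  ≡⟨ *-distribˡ-sumℚ (- 1ℚ) f ⟨
    - 1ℚ * sumℚ f            ≡⟨ -1*x≈-x (sumℚ f) ⟩
    - sumℚ f                 ∎

  sumℚ-distrib-- : (f g : Fin k → ℚ) → sumℚ (λ i → f i - g i) ≡ sumℚ f - sumℚ g
  sumℚ-distrib-- f g = trans (sumℚ-distrib-+ f (λ i → - g i)) (cong (sumℚ f +_) (sumℚ-neg g))

sumℚ-comm : ∀ {k l} (f : Fin k → Fin l → ℚ) →
  sumℚ (λ i → sumℚ (f i)) ≡ sumℚ (λ j → sumℚ (λ i → f i j))
sumℚ-comm f = begin
  sumℚ (λ i → sumℚ (f i))          ≡⟨ sumℚ-cong (λ i → sumℚ≡sum (f i)) ⟩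
  sumℚ (λ i → sum (f i))           ≡⟨ sumℚ≡sum (λ i → sum (f i)) ⟩
  sum (λ i → sum (f i))            ≡⟨ ∑-comm f ⟩
  sum (λ j → sum (λ i → f i j))    ≡⟨ sumℚ≡sum (λ j → sum (λ i → f i j)) ⟨
  sumℚ (λ j → sum (λ i → f i j))   ≡⟨ sumℚ-cong (λ j → sumℚ≡sum (λ i → f i j)) ⟨
  sumℚ (λ j → sumℚ (λ i → f i j))  ∎
  where open ≡-Reasoning

sumℚ-mono-≤ : ∀ {k} {f g : Fin k → ℚ} → (∀ i → f i ≤ g i) → sumℚ f ≤ sumℚ g
sumℚ-mono-≤ {zero}  f≤g = ℚ.≤-refl
sumℚ-mono-≤ {suc k} f≤g = ℚ.+-mono-≤ (f≤g zero) (sumℚ-mono-≤ (λ i → f≤g (suc i)))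

sumℚ-drop₂ : ∀ {k} (g : Fin (suc (suc k)) → ℚ) → g zero ≡ 0ℚ → g (suc zero) ≡ 0ℚ →
  sumℚ g ≡ sumℚ (λ j → g (suc (suc j)))
sumℚ-drop₂ g g₀≡0 g₁≡0 = begin
  g zero + (g (suc zero) + rest)  ≡⟨ cong₂ (λ s t → s + (t + rest)) g₀≡0 g₁≡0 ⟩
  0ℚ + (0ℚ + rest)                ≡⟨ ℚ.+-identityˡ (0ℚ + rest) ⟩
  0ℚ + rest                       ≡⟨ ℚ.+-identityˡ rest ⟩
  rest                            ∎
  where
  open ≡-Reasoning
  rest : ℚ
  rest = sumℚ (λ j → g (suc (suc j)))

sumℚ-κ : ∀ {n} (v : Fin n) (f : Fin n → ℚ) → sumℚ (λ i → κ v i * f i) ≡ f v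
sumℚ-κ {suc n} zero f = begin
  1ℚ * f zero + sumℚ (λ i → 0ℚ * f (suc i))
    ≡⟨ cong₂ _+_ (ℚ.*-identityˡ (f zero)) (sumℚ-zero _ (λ i → ℚ.*-zeroˡ (f (suc i)))) ⟩
  f zero + 0ℚ
    ≡⟨ ℚ.+-identityʳ (f zero) ⟩
  f zero
    ∎
  where open ≡-Reasoning
sumℚ-κ {suc n} (suc v) f =
  trans (cong₂ _+_ (ℚ.*-zeroˡ (f zero)) (sumℚ-κ v (λ i → f (suc i)))) (ℚ.+-identityˡ (f (suc v)))

-- Linear functionals

dot-cong : ∀ {n} (φ : Vec n) {x y : Vec n} → (∀ i → x i ≡ y i) → dot φ x ≡ dot φ y
dot-cong φ x≗y = sumℚ-cong (λ i → cong (φ i *_) (x≗y i))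

dot-zero : ∀ {n} (φ : Vec n) → dot φ (λ _ → 0ℚ) ≡ 0ℚ
dot-zero φ = sumℚ-zero _ (λ i → ℚ.*-zeroʳ (φ i))

dot-sum : ∀ {n k} (φ : Vec n) (f : Fin k → Vec n) →
  dot φ (λ i → sumℚ (λ j → f j i)) ≡ sumℚ (λ j → dot φ (f j))
dot-sum φ f = trans (sumℚ-cong (λ i → *-distribˡ-sumℚ (φ i) (λ j → f j i)))
                    (sumℚ-comm (λ i j → φ i * f j i))

dot-scale : ∀ {n} (φ : Vec n) (c : ℚ) (x : Vec n) → dot φ (λ i → c * x i) ≡ c * dot φ x
dot-scale φ c x = trans (sumℚ-cong (λ i → swap (φ i) (x i)))
                        (sym (*-distribˡ-sumℚ c (λ i → φ i * x i)))
  where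
  swap : ∀ p q → p * (c * q) ≡ c * (p * q)
  swap p q = trans (sym (ℚ.*-assoc p c q)) (trans (cong (_* q) (ℚ.*-comm p c)) (ℚ.*-assoc c p q))

dot-combination : ∀ {n k} (φ : Vec n) (c : Fin k → ℚ) (P : Fin k → Vec n) →
  dot φ (λ i → sumℚ (λ j → c j * P j i)) ≡ sumℚ (λ j → c j * dot φ (P j))
dot-combination φ c P = trans (dot-sum φ (λ j i → c j * P j i))
                              (sumℚ-cong (λ j → dot-scale φ (c j) (P j)))

dot-κ : ∀ {n} (φ : Vec n) (v : Fin n) → dot φ (κ v) ≡ φ v
dot-κ φ v = trans (sumℚ-cong (λ i → ℚ.*-comm (φ i) (κ v i))) (sumℚ-κ v φ)

dot-ε : ∀ {n} (φ : Vec n) (v w : Fin n) → dot φ (ε v w) ≡ φ v - φ w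
dot-ε φ v w = begin
  sumℚ (λ i → φ i * (κ v i - κ w i))      ≡⟨ sumℚ-cong (λ i → x[y-z]≈xy-xz (φ i) (κ v i) (κ w i)) ⟩
  sumℚ (λ i → φ i * κ v i - φ i * κ w i)  ≡⟨ sumℚ-distrib-- (λ i → φ i * κ v i) (λ i → φ i * κ w i) ⟩
  dot φ (κ v) - dot φ (κ w)               ≡⟨ cong₂ _-_ (dot-κ φ v) (dot-κ φ w) ⟩
  φ v - φ w                               ∎
  where open ≡-Reasoning

dot-ε-combination : ∀ {n} (φ : Vec n) {x : Vec n} (λ' : Fin n → Fin n → ℚ) →
  (∀ i → x i ≡ sumℚ (λ v → sumℚ (λ w → λ' v w * ε v w i))) →
  dot φ x ≡ sumℚ (λ v → sumℚ (λ w → λ' v w * (φ v - φ w)))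
dot-ε-combination φ {x} λ' x≡ = begin
  dot φ x                                                   ≡⟨ dot-cong φ x≡ ⟩
  dot φ (λ i → sumℚ (λ v → sumℚ (λ w → λ' v w * ε v w i)))
    ≡⟨ dot-sum φ (λ v i → sumℚ (λ w → λ' v w * ε v w i)) ⟩
  sumℚ (λ v → dot φ (λ i → sumℚ (λ w → λ' v w * ε v w i)))
    ≡⟨ sumℚ-cong (λ v → dot-combination φ (λ' v) (ε v)) ⟩
  sumℚ (λ v → sumℚ (λ w → λ' v w * dot φ (ε v w)))
    ≡⟨ sumℚ-cong (λ v → sumℚ-cong (λ w → cong (λ' v w *_) (dot-ε φ v w))) ⟩
  sumℚ (λ v → sumℚ (λ w → λ' v w * (φ v - φ w)))            ∎
  where open ≡-Reasoning

-- Indicator vectors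

κ-diag : ∀ {n} (v : Fin n) → κ v v ≡ 1ℚ
κ-diag v = cong (λ b → if b then 1ℚ else 0ℚ) (dec-true (v ≟ v) refl)

κ-off : ∀ {n} {v i : Fin n} → i ≢ v → κ v i ≡ 0ℚ
κ-off {v = v} {i} i≢v = cong (λ b → if b then 1ℚ else 0ℚ) (dec-false (i ≟ v) i≢v)

0≤κ : ∀ {n} (v i : Fin n) → 0ℚ ≤ κ v i
0≤κ v i = 0≤indicator (does (i ≟ v))
  where
  0≤indicator : ∀ b → 0ℚ ≤ (if b then 1ℚ else 0ℚ)
  0≤indicator true  = ℚ.nonNegative⁻¹ 1ℚ
  0≤indicator false = ℚ.≤-refl

κ≤1 : ∀ {n} (v i : Fin n) → κ v i ≤ 1ℚ
κ≤1 v i = indicator≤1 (does (i ≟ v))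
  where
  indicator≤1 : ∀ b → (if b then 1ℚ else 0ℚ) ≤ 1ℚ
  indicator≤1 true  = ℚ.≤-refl
  indicator≤1 false = ℚ.nonNegative⁻¹ 1ℚ

-‿mono-≤ : ∀ {p q r s} → p ≤ q → r ≤ s → p - s ≤ q - r
-‿mono-≤ p≤q r≤s = ℚ.+-mono-≤ p≤q (ℚ.neg-antimono-≤ r≤s)

ε-difference≤1 : ∀ {n} (v w x y : Fin n) → ¬ (x ≡ v × y ≡ w) → ε v w x - ε v w y ≤ 1ℚ
ε-difference≤1 v w x y xy≢vw = by-cases (x ≟ v)
  where
  by-cases : Dec (x ≡ v) → ε v w x - ε v w y ≤ 1ℚ
  by-cases (no x≢v)  = -‿mono-≤ (-‿mono-≤ (ℚ.≤-reflexive (κ-off x≢v)) (0≤κ w x))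
                                (-‿mono-≤ (0≤κ v y) (κ≤1 w y))
  by-cases (yes x≡v) = -‿mono-≤ (-‿mono-≤ (κ≤1 v x) (0≤κ w x))
                                (-‿mono-≤ (0≤κ v y) (ℚ.≤-reflexive (κ-off λ y≡w → xy≢vw (x≡v , y≡w))))

-- The polytope DE(Q)

module _ {n : ℕ} {Q : Quiver n} where

  ε∈DE : ∀ {v w} → E Q v w ≡ true → DE Q (ε v w)
  ε∈DE {v} {w} vw∈Q = λ' , λ'≥0 , λ'-supp , Σλ'≡1 , ε≡
    where
    open ≡-Reasoning
    λ' : Fin n → Fin n → ℚ
    λ' x y = κ v x * κ w y
    λ'≥0 : ∀ x y → 0ℚ ≤ λ' x y
    λ'≥0 x y = ℚ.nonNegative⁻¹ (λ' x y)
      {{ℚ.nonNeg*nonNeg⇒nonNeg (κ v x) {{nonNegative (0≤κ v x)}} (κ w y) {{nonNegative (0≤κ w y)}}}}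
    λ'-supp : ∀ x y → E Q x y ≡ false → λ' x y ≡ 0ℚ
    λ'-supp x y xy∉Q = by-cases (x ≟ v) (y ≟ w)
      where
      by-cases : Dec (x ≡ v) → Dec (y ≡ w) → λ' x y ≡ 0ℚ
      by-cases (no x≢v)   _          = trans (cong (_* κ w y) (κ-off x≢v)) (ℚ.*-zeroˡ (κ w y))
      by-cases (yes _)    (no y≢w)   = trans (cong (κ v x *_) (κ-off y≢w)) (ℚ.*-zeroʳ (κ v x))
      by-cases (yes refl) (yes refl) with () ← trans (sym vw∈Q) xy∉Q
    Σκ≡1 : ∀ u → sumℚ (κ u) ≡ 1ℚ
    Σκ≡1 u = trans (sumℚ-cong (λ i → sym (ℚ.*-identityʳ (κ u i)))) (sumℚ-κ u (λ _ → 1ℚ))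
    Σλ'≡1 : sumℚ (λ x → sumℚ (λ' x)) ≡ 1ℚ
    Σλ'≡1 = begin
      sumℚ (λ x → sumℚ (λ y → κ v x * κ w y))  ≡⟨ sumℚ-cong (λ x → *-distribˡ-sumℚ (κ v x) (κ w)) ⟨
      sumℚ (λ x → κ v x * sumℚ (κ w))          ≡⟨ sumℚ-κ v (λ _ → sumℚ (κ w)) ⟩
      sumℚ (κ w)                               ≡⟨ Σκ≡1 w ⟩
      1ℚ                                       ∎
    ε≡ : ∀ i → ε v w i ≡ sumℚ (λ x → sumℚ (λ y → λ' x y * ε x y i))
    ε≡ i = sym (begin
      sumℚ (λ x → sumℚ (λ y → κ v x * κ w y * ε x y i))
        ≡⟨ sumℚ-cong (λ x → sumℚ-cong (λ y → ℚ.*-assoc (κ v x) (κ w y) (ε x y i))) ⟩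
      sumℚ (λ x → sumℚ (λ y → κ v x * (κ w y * ε x y i)))
        ≡⟨ sumℚ-cong (λ x → *-distribˡ-sumℚ (κ v x) (λ y → κ w y * ε x y i)) ⟨
      sumℚ (λ x → κ v x * sumℚ (λ y → κ w y * ε x y i))
        ≡⟨ sumℚ-cong (λ x → cong (κ v x *_) (sumℚ-κ w (λ y → ε x y i))) ⟩
      sumℚ (λ x → κ v x * ε x w i)
        ≡⟨ sumℚ-κ v (λ x → ε x w i) ⟩
      ε v w i
        ∎)

  DE-mono : ∀ {R : Quiver n} → Lluf R Q → ∀ {x} → DE R x → DE Q x
  DE-mono {R} R⊆Q (λ' , λ'≥0 , λ'-supp , rest) =
    λ' , λ'≥0 , (λ v w vw∉Q → λ'-supp v w (∉Q⇒∉R v w vw∉Q)) , rest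
    where
    ∉Q⇒∉R : ∀ v w → E Q v w ≡ false → E R v w ≡ false
    ∉Q⇒∉R v w vw∉Q with E R v w in vw∈R
    ... | false = refl
    ... | true with () ← trans (sym (R⊆Q v w vw∈R)) vw∉Q

  DE-dot-≤ : (φ : Vec n) (β : ℚ) → (∀ v w → E Q v w ≡ true → φ v - φ w ≤ β) →
    ∀ {x} → DE Q x → dot φ x ≤ β
  DE-dot-≤ φ β bound {x} (λ' , λ'≥0 , λ'-supp , Σλ'≡1 , x≡) = begin
    dot φ x                                         ≡⟨ dot-ε-combination φ λ' x≡ ⟩
    sumℚ (λ v → sumℚ (λ w → λ' v w * (φ v - φ w)))  ≤⟨ sumℚ-mono-≤ (λ v → sumℚ-mono-≤ (term v)) ⟩
    sumℚ (λ v → sumℚ (λ w → λ' v w * β))            ≡⟨ sumℚ-cong (λ v → *-distribʳ-sumℚ β (λ' v)) ⟨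
    sumℚ (λ v → sumℚ (λ' v) * β)                    ≡⟨ *-distribʳ-sumℚ β (λ v → sumℚ (λ' v)) ⟨
    sumℚ (λ v → sumℚ (λ' v)) * β                    ≡⟨ cong (_* β) Σλ'≡1 ⟩
    1ℚ * β                                          ≡⟨ ℚ.*-identityˡ β ⟩
    β                                               ∎
    where
    open ℚ.≤-Reasoning
    term : ∀ v w → λ' v w * (φ v - φ w) ≤ λ' v w * β
    term v w with E Q v w in vw∈Q?
    ... | true  = ℚ.*-monoˡ-≤-nonNeg (λ' v w) {{nonNegative (λ'≥0 v w)}} (bound v w vw∈Q?)
    ... | false = subst (λ t → t * (φ v - φ w) ≤ t * β) (sym (λ'-supp v w vw∈Q?))
                        (ℚ.≤-reflexive (trans (ℚ.*-zeroˡ (φ v - φ w)) (sym (ℚ.*-zeroˡ β))))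

  DE-dot-≡0 : (φ : Vec n) → (∀ v w → E Q v w ≡ true → φ v ≡ φ w) →
    ∀ {x} → DE Q x → dot φ x ≡ 0ℚ
  DE-dot-≡0 φ flat (λ' , _ , λ'-supp , _ , x≡) =
    trans (dot-ε-combination φ λ' x≡) (sumℚ-zero _ (λ v → sumℚ-zero _ (term v)))
    where
    term : ∀ v w → λ' v w * (φ v - φ w) ≡ 0ℚ
    term v w with E Q v w in vw∈Q?
    ... | true  = trans (cong (λ t → λ' v w * (φ v - t)) (sym (flat v w vw∈Q?)))
                        (trans (cong (λ' v w *_) (ℚ.+-inverseʳ (φ v))) (ℚ.*-zeroʳ (λ' v w)))
    ... | false = trans (cong (_* (φ v - φ w)) (λ'-supp v w vw∈Q?)) (ℚ.*-zeroˡ (φ v - φ w))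

  -- The functional ε_{vw} takes the value 2 at ε_{vw} but at most 1 at ε_{xy} for every other pair.
  ε∉DE : ∀ {v w} → v ≢ w → E Q v w ≡ false → ¬ DE Q (ε v w)
  ε∉DE {v} {w} v≢w vw∉Q vw∈DE = toWitnessFalse {a? = 1ℚ + 1ℚ ≤? 1ℚ} _ 2≤1
    where
    ε·ε≡2 : dot (ε v w) (ε v w) ≡ (1ℚ - 0ℚ) - (0ℚ - 1ℚ)
    ε·ε≡2 = trans (dot-ε (ε v w) v w)
                  (cong₂ _-_ (cong₂ _-_ (κ-diag v) (κ-off v≢w))
                             (cong₂ _-_ (κ-off (v≢w ∘ sym)) (κ-diag w)))
    other-pair : ∀ x y → E Q x y ≡ true → ¬ (x ≡ v × y ≡ w)
    other-pair x y xy∈Q (refl , refl) with () ← trans (sym xy∈Q) vw∉Q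
    2≤1 : (1ℚ - 0ℚ) - (0ℚ - 1ℚ) ≤ 1ℚ
    2≤1 = subst (_≤ 1ℚ) ε·ε≡2
            (DE-dot-≤ (ε v w) 1ℚ (λ x y xy∈Q → ε-difference≤1 v w x y (other-pair x y xy∈Q)) vw∈DE)

-- Faces and affine rank

≤∧≢⇒< : ∀ {p q} → p ≤ q → p ≢ q → p < q
≤∧≢⇒< {p} {q} p≤q p≢q with ℚ.<-cmp p q
... | tri< p<q _ _ = p<q
... | tri≈ _ p≡q _ = contradiction p≡q p≢q
... | tri> _ _ q<p = contradiction (ℚ.<-≤-trans q<p p≤q) (ℚ.<-irrefl refl)

face-strict : ∀ {n} {F P : Vec n → Set} (a : Vec n) {b : ℚ} →
  (∀ x → P x → dot a x ≤ b) → (∀ x → F x ⇔ (P x × dot a x ≡ b)) →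
  ∀ {x} → P x → ¬ F x → dot a x < b
face-strict a valid face x∈P x∉F =
  ≤∧≢⇒< (valid _ x∈P) (λ on-face → x∉F (Equivalence.from (face _) (x∈P , on-face)))

Independent₂ : ℚ → ℚ → ℚ → ℚ → Set
Independent₂ α₀ β₀ α₁ β₁ =
  ∀ c₀ c₁ → c₀ * α₀ + c₁ * α₁ ≡ 0ℚ → c₀ * β₀ + c₁ * β₁ ≡ 0ℚ → c₀ ≡ 0ℚ × c₁ ≡ 0ℚ

affine-relation : ∀ {n k} (P : Fin k → Vec n) (c : Fin k → ℚ) →
  sumℚ c ≡ 0ℚ → (∀ i → sumℚ (λ j → c j * P j i) ≡ 0ℚ) →
  ∀ (φ : Vec n) (β : ℚ) → sumℚ (λ j → c j * (dot φ (P j) - β)) ≡ 0ℚ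
affine-relation P c Σc≡0 ΣcP≡0 φ β = begin
  sumℚ (λ j → c j * (dot φ (P j) - β))
    ≡⟨ sumℚ-cong (λ j → x[y-z]≈xy-xz (c j) (dot φ (P j)) β) ⟩
  sumℚ (λ j → c j * dot φ (P j) - c j * β)
    ≡⟨ sumℚ-distrib-- (λ j → c j * dot φ (P j)) (λ j → c j * β) ⟩
  sumℚ (λ j → c j * dot φ (P j)) - sumℚ (λ j → c j * β)
    ≡⟨ cong₂ _-_ (dot-combination φ c P) (*-distribʳ-sumℚ β c) ⟨
  dot φ (λ i → sumℚ (λ j → c j * P j i)) - sumℚ c * β
    ≡⟨ cong₂ _-_ (trans (dot-cong φ ΣcP≡0) (dot-zero φ)) (cong (_* β) Σc≡0) ⟩
  0ℚ - 0ℚ * β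
    ≡⟨ cong (λ t → 0ℚ - t) (ℚ.*-zeroˡ β) ⟩
  0ℚ
    ∎
  where open ≡-Reasoning

affInd-extend : ∀ {n k} {p : Fin k → Vec n} {x₀ x₁ : Vec n} (a χ : Vec n) (b : ℚ) →
  AffInd p → (∀ j → dot a (p j) ≡ b) → (∀ j → dot χ (p j) ≡ 0ℚ) →
  Independent₂ (dot a x₀ - b) (dot χ x₀) (dot a x₁ - b) (dot χ x₁) →
  AffInd (x₀ ∷ x₁ ∷ p)
affInd-extend {n} {k} {p} {x₀} {x₁} a χ b p-ind p-on-a p-on-χ indep c Σc≡0 ΣcP≡0 = c≡0
  where
  P : Fin (suc (suc k)) → Vec n
  P = x₀ ∷ x₁ ∷ p
  relation : ∀ φ β → (∀ j → dot φ (p j) ≡ β) →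
    c zero * (dot φ x₀ - β) + c (suc zero) * (dot φ x₁ - β) ≡ 0ℚ
  relation φ β p-on-φ =
    trans (cong (c zero * (dot φ x₀ - β) +_) (sym (trans (cong (c (suc zero) * (dot φ x₁ - β) +_) tail≡0)
                                                          (ℚ.+-identityʳ _))))
          (affine-relation P c Σc≡0 ΣcP≡0 φ β)
    where
    tail≡0 : sumℚ (λ j → c (suc (suc j)) * (dot φ (p j) - β)) ≡ 0ℚ
    tail≡0 = sumℚ-zero _ λ j →
      trans (cong (λ t → c (suc (suc j)) * (t - β)) (p-on-φ j))
            (trans (cong (c (suc (suc j)) *_) (ℚ.+-inverseʳ β)) (ℚ.*-zeroʳ (c (suc (suc j)))))
  c₀c₁≡0 : c zero ≡ 0ℚ × c (suc zero) ≡ 0ℚ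
  c₀c₁≡0 = indep (c zero) (c (suc zero)) (relation a b p-on-a)
             (subst₂ (λ s t → c zero * s + c (suc zero) * t ≡ 0ℚ)
                     (ℚ.+-identityʳ (dot χ x₀)) (ℚ.+-identityʳ (dot χ x₁)) (relation χ 0ℚ p-on-χ))
  c₀≡0 : c zero ≡ 0ℚ
  c₀≡0 = proj₁ c₀c₁≡0
  c₁≡0 : c (suc zero) ≡ 0ℚ
  c₁≡0 = proj₂ c₀c₁≡0
  c≡0 : ∀ j → c j ≡ 0ℚ
  c≡0 zero          = c₀≡0
  c≡0 (suc zero)    = c₁≡0
  c≡0 (suc (suc j)) = p-ind (λ j → c (suc (suc j)))
    (trans (sym (sumℚ-drop₂ c c₀≡0 c₁≡0)) Σc≡0)
    (λ i → trans (sym (sumℚ-drop₂ (λ j → c j * P j i)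
                         (trans (cong (_* x₀ i) c₀≡0) (ℚ.*-zeroˡ (x₀ i)))
                         (trans (cong (_* x₁ i) c₁≡0) (ℚ.*-zeroˡ (x₁ i)))))
                 (ΣcP≡0 i))
    j

affRank-skips-suc : ∀ {n k} {F P : Vec n → Set} {x₀ x₁ : Vec n} (a χ : Vec n) (b : ℚ) →
  (∀ {x} → F x → P x) → (∀ {x} → F x → dot a x ≡ b) → (∀ {x} → F x → dot χ x ≡ 0ℚ) →
  P x₀ → P x₁ → Independent₂ (dot a x₀ - b) (dot χ x₀) (dot a x₁ - b) (dot χ x₁) →
  AffRank F k → ¬ AffRank P (suc k)
affRank-skips-suc {P = P} {x₀} {x₁} a χ b F⊆P F-on-a F-on-χ x₀∈P x₁∈P indep
  ((p , p∈F , p-ind) , _) (_ , maximal) =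
  maximal (x₀ ∷ x₁ ∷ p) all∈P (affInd-extend a χ b p-ind (F-on-a ∘ p∈F) (F-on-χ ∘ p∈F) indep)
  where
  all∈P : ∀ j → P ((x₀ ∷ x₁ ∷ p) j)
  all∈P zero          = x₀∈P
  all∈P (suc zero)    = x₁∈P
  all∈P (suc (suc j)) = F⊆P (p∈F j)

*-cancelʳ-neg : ∀ {c α} → α < 0ℚ → c * α ≡ 0ℚ → c ≡ 0ℚ
*-cancelʳ-neg {c} {α} α<0 cα≡0 =
  ℚ.≤-antisym (ℚ.*-cancelʳ-≤-neg α {{negative α<0}} (ℚ.≤-reflexive (trans (ℚ.*-zeroˡ α) (sym cα≡0))))
              (ℚ.*-cancelʳ-≤-neg α {{negative α<0}} (ℚ.≤-reflexive (trans cα≡0 (sym (ℚ.*-zeroˡ α)))))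

independent₂-0-1 : ∀ {α₀ β₀ α₁ β₁} → α₀ < 0ℚ → β₀ ≡ 0ℚ → β₁ ≡ 1ℚ → Independent₂ α₀ β₀ α₁ β₁
independent₂-0-1 {α₀} {β₀} {α₁} {β₁} α₀<0 β₀≡0 β₁≡1 c₀ c₁ α-rel β-rel = c₀≡0 , c₁≡0
  where
  open ≡-Reasoning
  c₁≡0 : c₁ ≡ 0ℚ
  c₁≡0 = begin
    c₁                 ≡⟨ ℚ.+-identityˡ c₁ ⟨
    0ℚ + c₁            ≡⟨ cong₂ _+_ (ℚ.*-zeroʳ c₀) (ℚ.*-identityʳ c₁) ⟨
    c₀ * 0ℚ + c₁ * 1ℚ  ≡⟨ cong₂ (λ s t → c₀ * s + c₁ * t) β₀≡0 β₁≡1 ⟨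
    c₀ * β₀ + c₁ * β₁  ≡⟨ β-rel ⟩
    0ℚ                 ∎
  c₀≡0 : c₀ ≡ 0ℚ
  c₀≡0 = *-cancelʳ-neg α₀<0 (begin
    c₀ * α₀            ≡⟨ ℚ.+-identityʳ (c₀ * α₀) ⟨
    c₀ * α₀ + 0ℚ       ≡⟨ cong (c₀ * α₀ +_) (trans (cong (_* α₁) c₁≡0) (ℚ.*-zeroˡ α₁)) ⟨
    c₀ * α₀ + c₁ * α₁  ≡⟨ α-rel ⟩
    0ℚ                 ∎)

independent₂-1-−1 : ∀ {α₀ β₀ α₁ β₁} → α₀ < 0ℚ → α₁ < 0ℚ → β₀ ≡ 1ℚ → β₁ ≡ - 1ℚ →
  Independent₂ α₀ β₀ α₁ β₁
independent₂-1-−1 {α₀} {β₀} {α₁} {β₁} α₀<0 α₁<0 β₀≡1 β₁≡-1 c₀ c₁ α-rel β-rel =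
  c₀≡0 , trans (sym c₀≡c₁) c₀≡0
  where
  open ≡-Reasoning
  c₀≡c₁ : c₀ ≡ c₁
  c₀≡c₁ = x∙y⁻¹≈ε⇒x≈y c₀ c₁ (begin
    c₀ - c₁              ≡⟨ cong₂ _+_ (ℚ.*-identityʳ c₀) (trans (ℚ.*-comm c₁ (- 1ℚ)) (-1*x≈-x c₁)) ⟨
    c₀ * 1ℚ + c₁ * - 1ℚ  ≡⟨ cong₂ (λ s t → c₀ * s + c₁ * t) β₀≡1 β₁≡-1 ⟨
    c₀ * β₀ + c₁ * β₁    ≡⟨ β-rel ⟩
    0ℚ                   ∎)
  c₀≡0 : c₀ ≡ 0ℚ
  c₀≡0 = *-cancelʳ-neg (ℚ.+-mono-< α₀<0 α₁<0) (begin
    c₀ * (α₀ + α₁)     ≡⟨ ℚ.*-distribˡ-+ c₀ α₀ α₁ ⟩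
    c₀ * α₀ + c₀ * α₁  ≡⟨ cong (λ t → c₀ * α₀ + t * α₁) c₀≡c₁ ⟩
    c₀ * α₀ + c₁ * α₁  ≡⟨ α-rel ⟩
    0ℚ                 ∎)

-- Components and cycles

step-into : ∀ {m} {P : Fin (suc m) → Set} → Decidable P → ¬ P zero → P (fromℕ m) →
  ∃[ t ] (¬ P (inject₁ t) × P (suc t))
step-into {zero}  P? ¬P₀ Pₘ = contradiction Pₘ ¬P₀
step-into {suc m} P? ¬P₀ Pₘ with P? (suc zero)
... | yes P₁ = zero , ¬P₀ , P₁
... | no ¬P₁ with step-into (P? ∘ suc) ¬P₁ Pₘ
...   | t , ¬Pₜ , Pₜ₊₁ = suc t , ¬Pₜ , Pₜ₊₁

crossing-edge-on-walk : ∀ {n K} {Q : Quiver n} (c : Fin n → Fin K) {x y} →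
  Conn Q x y → c x ≢ c y → ∃[ s ] ∃[ t ] (E Q s t ≡ true × c s ≢ c t)
crossing-edge-on-walk c here cx≢cx = contradiction refl cx≢cx
crossing-edge-on-walk c (fwd {v} {w} vw∈Q walk) cv≢cy with c v ≟ c w
... | yes cv≡cw = crossing-edge-on-walk c walk (cv≢cy ∘ trans cv≡cw)
... | no cv≢cw  = v , w , vw∈Q , cv≢cw
crossing-edge-on-walk c (bwd {v} {w} wv∈Q walk) cv≢cy with c v ≟ c w
... | yes cv≡cw = crossing-edge-on-walk c walk (cv≢cy ∘ trans cv≡cw)
... | no cv≢cw  = w , v , wv∈Q , cv≢cw ∘ sym

crossing-edge : ∀ {n k} {Q : Quiver n} → NumComponents Q k →
  (c : Fin n → Fin (suc k)) → Surjective _≡_ _≡_ c →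
  ∃[ s ] ∃[ t ] (E Q s t ≡ true × c s ≢ c t)
crossing-edge {n} {k} (c-Q , _ , c-Q-conn) c c-onto =
  case Fin.pigeonhole (ℕ.n<1+n k) (c-Q ∘ rep) of λ where
    (i , j , i<j , same-Q-component) →
      crossing-edge-on-walk c (Equivalence.to (c-Q-conn (rep i) (rep j)) same-Q-component)
        (λ eq → Fin.<⇒≢ i<j (trans (sym (c∘rep i)) (trans eq (c∘rep j))))
  where
  rep : Fin (suc k) → Fin n
  rep i = proj₁ (c-onto i)
  c∘rep : ∀ i → c (rep i) ≡ i
  c∘rep i = proj₂ (c-onto i) refl

DiffEdge : ∀ {n} → Quiver n → Quiver n → Fin n → Fin n → Set
DiffEdge Q R v w = E Q v w ≡ true × E R v w ≡ false

module _ {n : ℕ} {Q R : Quiver n} where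

  facet-excludes-independent-pair : Lluf R Q → IsFacet (DE R) (DE Q) →
    (χ : Vec n) → (∀ {x} → DE R x → dot χ x ≡ 0ℚ) →
    ∀ {v₀ w₀ v₁ w₁} → DiffEdge Q R v₀ w₀ → DiffEdge Q R v₁ w₁ →
    ¬ (∀ {α₀ α₁} → α₀ < 0ℚ → α₁ < 0ℚ → Independent₂ α₀ (χ v₀ - χ w₀) α₁ (χ v₁ - χ w₁))
  facet-excludes-independent-pair R⊆Q ((a , b , valid , face) , _ , rank-R , rank-Q) χ χ-flat
    {v₀} {w₀} {v₁} {w₁} e₀ e₁ indep =
    affRank-skips-suc a χ b (DE-mono {Q = Q} {R = R} R⊆Q) (proj₂ ∘ Equivalence.to (face _)) χ-flat
      (ε∈DE {Q = Q} (proj₁ e₀)) (ε∈DE {Q = Q} (proj₁ e₁))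
      (subst₂ (λ β₀ β₁ → Independent₂ _ β₀ _ β₁) (sym (dot-ε χ v₀ w₀)) (sym (dot-ε χ v₁ w₁))
              (indep (below e₀) (below e₁)))
      rank-R rank-Q
    where
    below : ∀ {v w} → DiffEdge Q R v w → dot a (ε v w) - b < 0ℚ
    below {v} {w} (vw∈Q , vw∉R) =
      subst (dot a (ε v w) - b <_) (ℚ.+-inverseʳ b)
        (ℚ.+-mono-<-≤ (face-strict a valid face (ε∈DE {Q = Q} vw∈Q) (ε∉DE {Q = R} v≢w vw∉R))
                      (ℚ.≤-refl { - b}))
      where
      v≢w : v ≢ w
      v≢w refl with () ← trans (sym vw∈Q) (noLoop Q v)

  module _ {K : ℕ} (c : Fin n → Fin K) (c-resp : ∀ {v w} → Conn R v w → c v ≡ c w) where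

    indicator-vanishes-on-DE : (A : Fin K) → ∀ {x} → DE R x → dot (κ A ∘ c) x ≡ 0ℚ
    indicator-vanishes-on-DE A =
      DE-dot-≡0 {Q = R} (κ A ∘ c) (λ v w vw∈R → cong (κ A) (c-resp (fwd vw∈R here)))

    crossing⇒∉R : ∀ {s t} → c s ≢ c t → E R s t ≡ false
    crossing⇒∉R {s} {t} cs≢ct with E R s t in st∈R
    ... | false = refl
    ... | true  = contradiction (c-resp (fwd st∈R here)) cs≢ct

    cycle-cases : ∀ {m} (u : Fin (suc (suc m)) → Fin n) → Conn R (u (fromℕ (suc m))) (u zero) →
      (∀ t → ContrEdge Q R (u (inject₁ t)) (u (suc t))) →
      (∃[ v ] ∃[ w ] (DiffEdge Q R v w × c v ≡ c w))
      ⊎ (∃[ v₀ ] ∃[ w₀ ] ∃[ v₁ ] ∃[ w₁ ]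
           (DiffEdge Q R v₀ w₀ × DiffEdge Q R v₁ w₁ × c w₀ ≢ c v₀ × c v₁ ≢ c v₀ × c w₁ ≡ c v₀))
    cycle-cases u closed edges with edges zero
    ... | v₀ , w₀ , vw₀∈Q , vw₀∉R , v₀~u₀ , w₀~u₁ with c (u (suc zero)) ≟ c (u zero)
    ...   | yes u₁~u₀ =
      inj₁ (v₀ , w₀ , (vw₀∈Q , vw₀∉R) , trans (c-resp v₀~u₀) (trans (sym u₁~u₀) (sym (c-resp w₀~u₁))))
    ...   | no u₁≁u₀ with step-into (λ j → c (u (suc j)) ≟ c (u zero)) u₁≁u₀ (c-resp closed)
    ...     | t , uₜ≁u₀ , uₜ₊₁~u₀ with edges (suc t)
    ...       | v₁ , w₁ , vw₁∈Q , vw₁∉R , v₁~uₜ , w₁~uₜ₊₁ =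
      inj₂ (v₀ , w₀ , v₁ , w₁ , (vw₀∈Q , vw₀∉R) , (vw₁∈Q , vw₁∉R) ,
            (λ eq → u₁≁u₀ (trans (sym (c-resp w₀~u₁)) (trans eq (c-resp v₀~u₀)))) ,
            (λ eq → uₜ≁u₀ (trans (sym (c-resp v₁~uₜ)) (trans eq (c-resp v₀~u₀)))) ,
            trans (c-resp w₁~uₜ₊₁) (trans uₜ₊₁~u₀ (sym (c-resp v₀~u₀))))

lemma4p6 : ∀ {n} (Q R : Quiver n) → Lluf R Q
    → (k : ℕ) → NumComponents Q k → NumComponents R (suc k)
    → IsFacet (DE R) (DE Q)
    → ContractionAcyclic Q R
lemma4p6 Q R R⊆Q k Q-comps (c , c-onto , c-conn) facet (zero , _ , () , _)
lemma4p6 Q R R⊆Q k Q-comps (c , c-onto , c-conn) facet (suc m , u , _ , closed , edges) =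
  case cycle-cases {Q = Q} c c-resp u closed edges of λ where
    (inj₁ (v₀ , w₀ , e₀ , cv₀≡cw₀)) →
      let (s , t , st∈Q , cs≢ct) = crossing-edge Q-comps c c-onto in
      forbid (c s) e₀ (st∈Q , crossing⇒∉R {Q = Q} c c-resp cs≢ct) λ α₀<0 _ →
        independent₂-0-1 α₀<0
          (trans (cong (λ B → κ (c s) (c v₀) - κ (c s) B) (sym cv₀≡cw₀)) (ℚ.+-inverseʳ (κ (c s) (c v₀))))
          (cong₂ _-_ (κ-diag (c s)) (κ-off (cs≢ct ∘ sym)))
    (inj₂ (v₀ , w₀ , v₁ , w₁ , e₀ , e₁ , cw₀≢cv₀ , cv₁≢cv₀ , cw₁≡cv₀)) →
      forbid (c v₀) e₀ e₁ λ α₀<0 α₁<0 →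
        independent₂-1-−1 α₀<0 α₁<0
          (cong₂ _-_ (κ-diag (c v₀)) (κ-off cw₀≢cv₀))
          (cong₂ _-_ (κ-off cv₁≢cv₀) (trans (cong (κ (c v₀)) cw₁≡cv₀) (κ-diag (c v₀))))
  where
  c-resp : ∀ {v w} → Conn R v w → c v ≡ c w
  c-resp = Equivalence.from (c-conn _ _)
  forbid : (A : Fin (suc k)) → ∀ {v₀ w₀ v₁ w₁} → DiffEdge Q R v₀ w₀ → DiffEdge Q R v₁ w₁ →
    ¬ (∀ {α₀ α₁} → α₀ < 0ℚ → α₁ < 0ℚ →
         Independent₂ α₀ (κ A (c v₀) - κ A (c w₀)) α₁ (κ A (c v₁) - κ A (c w₁)))
  forbid A = facet-excludes-independent-pair {Q = Q} {R = R} R⊆Q facet (κ A ∘ c)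
               (indicator-vanishes-on-DE {Q = Q} c c-resp A)
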